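{- Let $T$ be a tree. Then $T$ is a vertex-minor of a subcubic tree $T'$ with $|V(T')|\le 5|V(T)|$.
   Context: A subcubic tree is a tree in which every vertex has degree at most $3$. The local complementation at a vertex $x$ replaces the subgraph induced on the neighbourhood of $x$ by its complement; $H$ is a vertex-minor of $G$ if $H$ can be obtained from $G$ by a sequence of local complementations and vertex deletions. -}

module Defs where

open import Data.Nat using (ℕ; zero; suc; _+_; _≤_)
open import Data.Bool using (Bool; true; false; not; _∧_; _xor_; if_then_else_)
open import Data.Fin using (Fin; zero; suc; inject₁; fromℕ; _≟_)
open import Data.List using (List; foldl; map; allFin)
open import Data.Nat.ListAction using (sum)
open import Data.Product using (Σ; _×_)
open import Relation.Nullary.Decidable using (⌊_⌋)
open import Relation.Binary.PropositionalEquality using (_≡_)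
open import Function.Definitions using (Injective)

Adj : ℕ → Set
Adj n = Fin n → Fin n → Bool

IsGraph : {n : ℕ} → Adj n → Set
IsGraph {n} A = (∀ i j → A i j ≡ A j i) × (∀ i → A i i ≡ false)

-- Local complementation at x: complement the subgraph induced on N(x).
lc : {n : ℕ} → Fin n → Adj n → Adj n
lc x A i j = A i j xor (A x i ∧ A x j ∧ not ⌊ i ≟ j ⌋)

lcSeq : {n : ℕ} → List (Fin n) → Adj n → Adj n
lcSeq xs A = foldl (λ B x → lc x B) A xs

VertexMinor : {m n : ℕ} → Adj m → Adj n → Set
VertexMinor {m} {n} H G =
  Σ (List (Fin n)) λ xs →
  Σ (Fin m → Fin n) λ f →
  Injective _≡_ _≡_ f × (∀ i j → H i j ≡ lcSeq xs G (f i) (f j))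

deg : {n : ℕ} → Adj n → Fin n → ℕ
deg {n} A v = sum (map (λ j → if A v j then 1 else 0) (allFin n))

Subcubic : {n : ℕ} → Adj n → Set
Subcubic A = ∀ v → deg A v ≤ 3

data Walk {n : ℕ} (A : Adj n) : Fin n → Fin n → Set where
  here : ∀ {i} → Walk A i i
  step : ∀ {i k j} → A i k ≡ true → Walk A k j → Walk A i j

Connected : {n : ℕ} → Adj n → Set
Connected A = ∀ i j → Walk A i j

Cycle : {n : ℕ} → Adj n → Set
Cycle {n} A =
  Σ ℕ λ k →
  Σ (Fin (suc (suc (suc k))) → Fin n) λ c →
  Injective _≡_ _≡_ c ×
  (∀ (t : Fin (suc (suc k))) → A (c (inject₁ t)) (c (suc t)) ≡ true) ×
  A (c (fromℕ (suc (suc k)))) (c zero) ≡ true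

Acyclic : {n : ℕ} → Adj n → Set
Acyclic A = Cycle A → Data.Empty.⊥
  where import Data.Empty

IsTree : {n : ℕ} → Adj n → Set
IsTree {n} A = 1 ≤ n × IsGraph A × Connected A × Acyclic A

-- Induction on the number of vertices, removing a leaf. Alongside T we carry a subcubic tree in
-- which T appears as an induced subgraph after local complementations at some pivots, each vertex
-- i of T having a pendant handle that, among the copy of T and the handles, sees only i. To attach
-- a new leaf to u, hang the path hub – newVertex – newHandle, plus a leaf freshHandle on hub, from
-- the handle h of u, and complement locally at hub and then at h. Afterwards newVertex sees exactly
-- the former neighbours of h, that is u; newHandle is its handle and freshHandle the new handle of
-- u. On the old vertices the effect is a local complementation at h, which changes nothing among
-- the copy of T and the other handles because h sees only u there. Each leaf costs four vertices
-- and raises the degree of h from one to two, so the tree stays subcubic with at most 5n vertices.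

module Submission where

open import Defs
open import Data.Nat using (ℕ; zero; suc; _+_; _*_; _≤_; _<_; z≤n; s≤s; s≤s⁻¹)
open import Data.Nat.Properties
  using (≤-reflexive; ≤-trans; <-≤-trans; ≤⇒≯; n≤1+n; m≤m+n; +-monoʳ-≤; +-suc; *-suc; m≢1+n+m;
         module ≤-Reasoning;
         anyUpTo?)
open import Data.Bool using (Bool; true; false; if_then_else_)
open import Data.Bool.Properties using (xor-identityʳ; ∧-zeroʳ; ∧-identityʳ)
import Data.Bool.Properties as Boolₚ
open import Data.Fin using (Fin; zero; suc; toℕ; inject₁; fromℕ; _≟_; punchOut; _↑ʳ_)
open import Data.Fin.Properties
  using (0≢1+n; suc-injective; ↑ʳ-injective; toℕ-injective; toℕ<n; toℕ-inject₁; toℕ-fromℕ;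
         injective⇒≤; punchIn-punchOut; any?)
open import Data.Fin.Relation.Unary.Top using (view; ‵fromℕ; ‵inject₁)
open import Data.Fin.Permutation
  using (Permutation′; _⟨$⟩ʳ_; _⟨$⟩ˡ_; inverseʳ; inverseˡ; transpose; flip)
open import Data.List using (List; []; _∷_; _++_; map; allFin; tabulate)
open import Data.List.Properties using (foldl-++; map-tabulate; map-cong)
open import Data.List.Relation.Unary.All using (All; []; _∷_)
open import Data.List.Relation.Unary.All.Properties using (++⁺)
open import Data.Nat.ListAction using (sum)
open import Data.Product using (Σ; ∃; _×_; _,_; proj₁; proj₂)
open import Data.Empty using (⊥-elim)
open import Function using (_∘_; id)
open import Function.Definitions using (Injective)
open import Relation.Nullary using (Dec; yes; no; contradiction)
open import Relation.Nullary.Decidable using (⌊_⌋; ⌊⌋-map′; ¬?; _×-dec_; decidable-stable)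
open import Relation.Binary.PropositionalEquality

private
  variable
    k l m n : ℕ

⌊≟⌋-refl : (i : Fin n) → ⌊ i ≟ i ⌋ ≡ true
⌊≟⌋-refl i with i ≟ i
... | yes _   = refl
... | no i≢i = contradiction refl i≢i

⌊≟⌋-≢ : {i j : Fin n} → i ≢ j → ⌊ i ≟ j ⌋ ≡ false
⌊≟⌋-≢ {i = i} {j} i≢j with i ≟ j
... | yes i≡j = contradiction i≡j i≢j
... | no _    = refl

⌊≟⌋-true : {i j : Fin n} → ⌊ i ≟ j ⌋ ≡ true → i ≡ j
⌊≟⌋-true {i = i} {j} eq with i ≟ j | eq
... | yes i≡j | _ = i≡j
... | no _    | ()

⌊≟⌋-injective : {f : Fin m → Fin n} → Injective _≡_ _≡_ f →
                ∀ i j → ⌊ f i ≟ f j ⌋ ≡ ⌊ i ≟ j ⌋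
⌊≟⌋-injective {f = f} f-inj i j with i ≟ j
... | yes refl = ⌊≟⌋-refl (f i)
... | no i≢j   = ⌊≟⌋-≢ (i≢j ∘ f-inj)

⌊≟⌋-sym : (i j : Fin n) → ⌊ i ≟ j ⌋ ≡ ⌊ j ≟ i ⌋
⌊≟⌋-sym i j with i ≟ j
... | yes refl = sym (⌊≟⌋-refl i)
... | no i≢j   = sym (⌊≟⌋-≢ (i≢j ∘ sym))

⌊≟⌋-suc : (i j : Fin n) → ⌊ suc i ≟ suc j ⌋ ≡ ⌊ i ≟ j ⌋
⌊≟⌋-suc i j = ⌊⌋-map′ (cong suc) suc-injective (i ≟ j)

infix 4 _≗₂_
_≗₂_ : Adj n → Adj n → Set
A ≗₂ B = ∀ i j → A i j ≡ B i j

≗₂-trans : {A B C : Adj n} → A ≗₂ B → B ≗₂ C → A ≗₂ C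
≗₂-trans A≗B B≗C i j = trans (A≗B i j) (B≗C i j)

relabel : (Fin m → Fin n) → Adj n → Adj m
relabel τ A i j = A (τ i) (τ j)

_++ᵂ_ : {A : Adj n} {i j l : Fin n} → Walk A i j → Walk A j l → Walk A i l
here         ++ᵂ w = w
step edge w′ ++ᵂ w = step edge (w′ ++ᵂ w)

Walk-map : {A : Adj m} {B : Adj n} (τ : Fin m → Fin n) →
           (∀ {i j} → A i j ≡ true → B (τ i) (τ j) ≡ true) →
           ∀ {i j} → Walk A i j → Walk B (τ i) (τ j)
Walk-map τ hom here          = here
Walk-map τ hom (step edge w) = step (hom edge) (Walk-map τ hom w)

adjacent⇒≢ : {A : Adj n} → (∀ i → A i i ≡ false) → ∀ {x y} → A x y ≡ true → x ≢ y
adjacent⇒≢ loopless {x} edge refl = contradiction (trans (sym (loopless x)) edge) λ ()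

IsCycle : Adj n → (k : ℕ) → (Fin (3 + k) → Fin n) → Set
IsCycle A k c =
  Injective _≡_ _≡_ c ×
  (∀ (t : Fin (2 + k)) → A (c (inject₁ t)) (c (suc t)) ≡ true) ×
  A (c (fromℕ (2 + k))) (c zero) ≡ true

IsCycle-cong : {A : Adj n} {c d : Fin (3 + k) → Fin n} →
               (∀ t → c t ≡ d t) → IsCycle A k c → IsCycle A k d
IsCycle-cong {n = n} {A = A} c≗d (c-inj , edges , closing) =
  (λ e → c-inj (trans (c≗d _) (trans e (sym (c≗d _))))) ,
  (λ t → subst₂ Edge (c≗d _) (c≗d _) (edges t)) ,
  subst₂ Edge (c≗d _) (c≗d _) closing
  where
  Edge : Fin n → Fin n → Set
  Edge x y = A x y ≡ true

IsCycle-relabel : {A : Adj n} {τ : Fin m → Fin n} {c : Fin (3 + k) → Fin m} →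
                  IsCycle A k (τ ∘ c) → IsCycle (relabel τ A) k c
IsCycle-relabel {τ = τ} (τc-inj , edges , closing) = τc-inj ∘ cong τ , edges , closing

relabel-acyclic : {A : Adj n} {τ : Fin m → Fin n} → Injective _≡_ _≡_ τ →
                  Acyclic A → Acyclic (relabel τ A)
relabel-acyclic τ-inj acyclic (k , c , c-inj , edges , closing) =
  acyclic (k , _ , c-inj ∘ τ-inj , edges , closing)

-- In a cycle every vertex has an in-neighbour and an out-neighbour on the cycle, and they differ.
pendant-off-cycle : {A : Adj n} {v p : Fin n} →
                    (∀ x → A v x ≡ true → x ≡ p) → (∀ x → A x v ≡ true → x ≡ p) →
                    {c : Fin (3 + k) → Fin n} → IsCycle A k c → ∀ t → c t ≢ v
pendant-off-cycle {n} {k} {A} {v} {p} out-unique in-unique {c} (c-inj , edges , closing) = impossible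
  where
  clash : ∀ {t s s′} → c t ≡ v → A (c t) (c s) ≡ true → A (c s′) (c t) ≡ true → s ≡ s′
  clash ct≡v out-edge in-edge =
    c-inj (trans (out-unique _ (subst (λ y → A y _ ≡ true) ct≡v out-edge))
                 (sym (in-unique _ (subst (λ y → A _ y ≡ true) ct≡v in-edge))))

  impossible : ∀ t → c t ≢ v
  impossible zero    ct≡v = 0≢1+n (suc-injective (clash ct≡v (edges zero) closing))
  impossible (suc s) ct≡v with view s
  ... | ‵fromℕ     = 0≢1+n (clash ct≡v closing (edges s))
  ... | ‵inject₁ r = m≢1+n+m (toℕ r) (begin
    toℕ r                       ≡⟨ toℕ-inject₁ r ⟨
    toℕ (inject₁ r)             ≡⟨ toℕ-inject₁ _ ⟨
    toℕ (inject₁ (inject₁ r))   ≡⟨ cong toℕ (clash ct≡v (edges (suc r)) (edges (inject₁ r))) ⟨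
    toℕ (suc (suc r))           ∎)
    where open ≡-Reasoning

addLeaf : Adj n → Fin n → Adj (suc n)
addLeaf A p zero    zero    = false
addLeaf A p zero    (suc j) = ⌊ p ≟ j ⌋
addLeaf A p (suc i) zero    = ⌊ p ≟ i ⌋
addLeaf A p (suc i) (suc j) = A i j

addLeaf-cong : {A B : Adj n} (p : Fin n) → A ≗₂ B → addLeaf A p ≗₂ addLeaf B p
addLeaf-cong p A≗B zero    zero    = refl
addLeaf-cong p A≗B zero    (suc j) = refl
addLeaf-cong p A≗B (suc i) zero    = refl
addLeaf-cong p A≗B (suc i) (suc j) = A≗B i j

addLeaf-leaf : {A : Adj n} {p : Fin n} → ∀ x → addLeaf A p zero x ≡ true → x ≡ suc p
addLeaf-leaf (suc j) e = cong suc (sym (⌊≟⌋-true e))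

addLeaf-leaf′ : {A : Adj n} {p : Fin n} → ∀ x → addLeaf A p x zero ≡ true → x ≡ suc p
addLeaf-leaf′ (suc i) e = cong suc (sym (⌊≟⌋-true e))

addLeaf-isGraph : {A : Adj n} (p : Fin n) → IsGraph A → IsGraph (addLeaf A p)
addLeaf-isGraph {A = A} p (symmetric , loopless) = symmetric′ , loopless′
  where
  symmetric′ : ∀ i j → addLeaf A p i j ≡ addLeaf A p j i
  symmetric′ zero    zero    = refl
  symmetric′ zero    (suc j) = refl
  symmetric′ (suc i) zero    = refl
  symmetric′ (suc i) (suc j) = symmetric i j
  loopless′ : ∀ i → addLeaf A p i i ≡ false
  loopless′ zero    = refl
  loopless′ (suc i) = loopless i

addLeaf-connected : {A : Adj n} (p : Fin n) → Connected A → Connected (addLeaf A p)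
addLeaf-connected p connected zero    zero    = here
addLeaf-connected p connected zero    (suc j) = step (⌊≟⌋-refl p) (Walk-map suc id (connected p j))
addLeaf-connected p connected (suc i) zero    = Walk-map suc id (connected i p) ++ᵂ step (⌊≟⌋-refl p) here
addLeaf-connected p connected (suc i) (suc j) = Walk-map suc id (connected i j)

addLeaf-acyclic : {A : Adj n} (p : Fin n) → Acyclic A → Acyclic (addLeaf A p)
addLeaf-acyclic {n} {A} p acyclic (k , c , cycle) with any? (λ t → c t ≟ zero)
... | yes (t , ct≡0) =
  pendant-off-cycle {A = addLeaf A p} (addLeaf-leaf {A = A}) (addLeaf-leaf′ {A = A}) cycle t ct≡0
... | no avoids-0 =
  acyclic (k , c′ , IsCycle-relabel {A = addLeaf A p} {τ = suc} (IsCycle-cong {A = addLeaf A p} c≗suc∘c′ cycle))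
  where
  c′ : Fin (3 + k) → Fin n
  c′ t = punchOut {i = zero} (λ 0≡ct → avoids-0 (t , sym 0≡ct))
  c≗suc∘c′ : ∀ t → c t ≡ suc (c′ t)
  c≗suc∘c′ t = sym (punchIn-punchOut {i = zero} _)

addLeaf-isTree : {A : Adj n} (p : Fin n) → IsTree A → IsTree (addLeaf A p)
addLeaf-isTree p (_ , graph , connected , acyclic) =
  s≤s z≤n , addLeaf-isGraph p graph , addLeaf-connected p connected , addLeaf-acyclic p acyclic

count : (Fin n → Bool) → ℕ
count {n} f = sum (map (λ j → if f j then 1 else 0) (allFin n))

count-suc : (f : Fin (suc n) → Bool) → count f ≡ (if f zero then 1 else 0) + count (f ∘ suc)
count-suc {n} f = cong ((if f zero then 1 else 0) +_) (cong sum (begin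
  map g (tabulate {n = n} suc) ≡⟨ map-tabulate suc g ⟩
  tabulate (g ∘ suc)      ≡⟨ map-tabulate id (g ∘ suc) ⟨
  map (g ∘ suc) (allFin n) ∎))
  where
  open ≡-Reasoning
  g : Fin (suc n) → ℕ
  g j = if f j then 1 else 0

count-cong : {f g : Fin n → Bool} → (∀ j → f j ≡ g j) → count f ≡ count g
count-cong {n} f≗g = cong sum (map-cong (λ j → cong (if_then 1 else 0) (f≗g j)) (allFin n))

count-false : count {n} (λ _ → false) ≡ 0
count-false {zero}  = refl
count-false {suc n} = trans (count-suc {n} (λ _ → false)) (count-false {n})

count-≟ : (p : Fin n) → count (λ j → ⌊ p ≟ j ⌋) ≡ 1
count-≟ {suc n} zero    = trans (count-suc {n} (λ j → ⌊ zero ≟ j ⌋)) (cong suc (count-false {n}))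
count-≟ {suc n} (suc p) =
  trans (count-suc {n} (λ j → ⌊ suc p ≟ j ⌋)) (trans (count-cong (⌊≟⌋-suc p)) (count-≟ p))

deg-addLeaf-leaf : (A : Adj n) (p : Fin n) → deg (addLeaf A p) zero ≡ 1
deg-addLeaf-leaf A p = trans (count-suc (addLeaf A p zero)) (count-≟ p)

deg-addLeaf-suc : (A : Adj n) (p v : Fin n) →
                  deg (addLeaf A p) (suc v) ≡ (if ⌊ p ≟ v ⌋ then 1 else 0) + deg A v
deg-addLeaf-suc A p v = count-suc (addLeaf A p (suc v))

lc-cong : {A B : Adj n} (x : Fin n) → A ≗₂ B → lc x A ≗₂ lc x B
lc-cong x A≗B i j rewrite A≗B i j | A≗B x i | A≗B x j = refl

lcSeq-cong : {A B : Adj n} (xs : List (Fin n)) → A ≗₂ B → lcSeq xs A ≗₂ lcSeq xs B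
lcSeq-cong []       A≗B = A≗B
lcSeq-cong (x ∷ xs) A≗B = lcSeq-cong xs (lc-cong x A≗B)

lcSeq-++ : (xs ys : List (Fin n)) (A : Adj n) → lcSeq (xs ++ ys) A ≡ lcSeq ys (lcSeq xs A)
lcSeq-++ xs ys A = foldl-++ (λ B x → lc x B) A xs ys

lc-isGraph : {A : Adj n} (x : Fin n) → IsGraph A → IsGraph (lc x A)
lc-isGraph {A = A} x (symmetric , loopless) = symmetric′ , loopless′
  where
  symmetric′ : ∀ i j → lc x A i j ≡ lc x A j i
  symmetric′ i j rewrite symmetric i j | ⌊≟⌋-sym i j with A x i | A x j
  ... | true  | true  = refl
  ... | true  | false = refl
  ... | false | true  = refl
  ... | false | false = refl
  loopless′ : ∀ i → lc x A i i ≡ false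
  loopless′ i rewrite ⌊≟⌋-refl i | loopless i | ∧-zeroʳ (A x i) | ∧-zeroʳ (A x i) = refl

lcSeq-isGraph : {A : Adj n} (xs : List (Fin n)) → IsGraph A → IsGraph (lcSeq xs A)
lcSeq-isGraph []       graph = graph
lcSeq-isGraph (x ∷ xs) graph = lcSeq-isGraph xs (lc-isGraph x graph)

lc-unchanged : {A : Adj n} {v x y : Fin n} → (A v x ≡ true → A v y ≡ true → x ≡ y) →
               lc v A x y ≡ A x y
lc-unchanged {A = A} {v} {x} {y} joint with A v x | A v y
... | false | _     = xor-identityʳ (A x y)
... | true  | false = xor-identityʳ (A x y)
... | true  | true  with refl ← joint refl refl rewrite ⌊≟⌋-refl x = xor-identityʳ (A x x)

lc-unchanged-off : {A : Adj n} {v x y : Fin n} → A v x ≡ false → lc v A x y ≡ A x y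
lc-unchanged-off {A = A} {x = x} {y} vx rewrite vx = xor-identityʳ (A x y)

lc-addLeaf : {A : Adj n} {p x : Fin n} → x ≢ p → lc (suc x) (addLeaf A p) ≗₂ addLeaf (lc x A) p
lc-addLeaf {A = A} {p} {x} x≢p = go
  where
  p≟x : ⌊ p ≟ x ⌋ ≡ false
  p≟x = ⌊≟⌋-≢ (x≢p ∘ sym)
  go : lc (suc x) (addLeaf A p) ≗₂ addLeaf (lc x A) p
  go zero    zero    rewrite p≟x = refl
  go zero    (suc j) rewrite p≟x = xor-identityʳ _
  go (suc i) zero    rewrite p≟x | ∧-zeroʳ (A x i) = xor-identityʳ _
  go (suc i) (suc j) rewrite ⌊≟⌋-suc i j = refl

map-suc-avoids-zero : (xs : List (Fin n)) → All (λ (y : Fin (suc n)) → y ≢ zero) (map suc xs)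
map-suc-avoids-zero []       = []
map-suc-avoids-zero (x ∷ xs) = (0≢1+n ∘ sym) ∷ map-suc-avoids-zero xs

map-suc-avoids : {p : Fin n} {xs : List (Fin n)} → All (_≢ p) xs → All (_≢ suc p) (map suc xs)
map-suc-avoids []             = []
map-suc-avoids (x≢p ∷ xs≢p) = (x≢p ∘ suc-injective) ∷ map-suc-avoids xs≢p

lcSeq-addLeaf : {A : Adj n} {p : Fin n} (xs : List (Fin n)) → All (_≢ p) xs →
                lcSeq (map suc xs) (addLeaf A p) ≗₂ addLeaf (lcSeq xs A) p
lcSeq-addLeaf []       []             = λ _ _ → refl
lcSeq-addLeaf (x ∷ xs) (x≢p ∷ xs≢p) i j =
  trans (lcSeq-cong (map suc xs) (lc-addLeaf x≢p) i j) (lcSeq-addLeaf xs xs≢p i j)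

-- Every tree with two vertices has a leaf

-- A path with k edges listed from its growing end, vertex 0; values at indices above k are junk.
record Path (A : Adj n) (k : ℕ) : Set where
  field
    vertex   : ℕ → Fin n
    adjacent : ∀ {i} → i < k → A (vertex i) (vertex (suc i)) ≡ true
    distinct : ∀ {i j} → i ≤ k → j ≤ k → vertex i ≡ vertex j → i ≡ j

open Path

module _ {A : Adj n} where

  Path-length< : Path A k → k < n
  Path-length< {k} P = injective⇒≤ {f = λ (t : Fin (suc k)) → vertex P (toℕ t)}
                                    (λ e → toℕ-injective (distinct P (below _) (below _) e))
    where
    below : (t : Fin (suc k)) → toℕ t ≤ k
    below t = s≤s⁻¹ (toℕ<n t)

  trivialPath : Fin n → Path A 0
  trivialPath v = record { vertex = λ _ → v ; adjacent = λ () ; distinct = λ { z≤n z≤n _ → refl } }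

  prepend : (P : Path A k) (u : Fin n) → A u (vertex P 0) ≡ true →
            (∀ {i} → i ≤ k → vertex P i ≢ u) → Path A (suc k)
  prepend {k} P u edge fresh = record { vertex = vertex′ ; adjacent = adjacent′ ; distinct = distinct′ }
    where
    vertex′ : ℕ → Fin n
    vertex′ zero    = u
    vertex′ (suc i) = vertex P i
    adjacent′ : ∀ {i} → i < suc k → A (vertex′ i) (vertex′ (suc i)) ≡ true
    adjacent′ {zero}  _         = edge
    adjacent′ {suc i} (s≤s i<k) = adjacent P i<k
    distinct′ : ∀ {i j} → i ≤ suc k → j ≤ suc k → vertex′ i ≡ vertex′ j → i ≡ j
    distinct′ {zero}  {zero}  _         _         _ = refl
    distinct′ {zero}  {suc j} _         (s≤s j≤k) e = contradiction (sym e) (fresh j≤k)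
    distinct′ {suc i} {zero}  (s≤s i≤k) _         e = contradiction e (fresh i≤k)
    distinct′ {suc i} {suc j} (s≤s i≤k) (s≤s j≤k) e = cong suc (distinct P i≤k j≤k e)

  chord-cycle : (P : Path A k) {i : ℕ} → 2 ≤ i → i ≤ k →
                A (vertex P i) (vertex P 0) ≡ true → Cycle A
  chord-cycle {k} P {suc (suc K)} (s≤s (s≤s z≤n)) i≤k chord = K , c , c-inj , edges , closing
    where
    c : Fin (3 + K) → Fin n
    c t = vertex P (toℕ t)
    within : (t : Fin (3 + K)) → toℕ t ≤ k
    within t = ≤-trans (s≤s⁻¹ (toℕ<n t)) i≤k
    c-inj : Injective _≡_ _≡_ c
    c-inj e = toℕ-injective (distinct P (within _) (within _) e)
    edges : ∀ (t : Fin (2 + K)) → A (c (inject₁ t)) (c (suc t)) ≡ true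
    edges t rewrite toℕ-inject₁ t = adjacent P (<-≤-trans (toℕ<n t) i≤k)
    closing : A (c (fromℕ (2 + K))) (c zero) ≡ true
    closing rewrite toℕ-fromℕ (2 + K) = chord

record Leaf (A : Adj n) : Set where
  field
    leaf parent : Fin n
    leaf-parent : A leaf parent ≡ true
    leaf-unique : ∀ x → A leaf x ≡ true → x ≡ parent

  leaf-row : ∀ x → A leaf x ≡ ⌊ parent ≟ x ⌋
  leaf-row x with parent ≟ x
  ... | yes refl = leaf-parent
  ... | no parent≢x with A leaf x in edge
  ...   | false = refl
  ...   | true  = contradiction (sym (leaf-unique x edge)) parent≢x

-- Grow a path at its end until the end has no neighbour off the path; by acyclicity it is then a leaf.
tree-leaf : {A : Adj (2 + k)} → IsTree A → Leaf A
tree-leaf {k} {A} (_ , (symmetric , loopless) , connected , acyclic) = start (connected zero (suc zero))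
  where
  head-neighbour : ∀ {l i} (P : Path A l) → i ≤ l → A (vertex P 0) (vertex P i) ≡ true → i ≡ 1
  head-neighbour {i = zero}          P _   edge = contradiction refl (adjacent⇒≢ {A = A} loopless edge)
  head-neighbour {i = suc zero}      P _   _    = refl
  head-neighbour {i = suc (suc i)}   P i≤l edge =
    ⊥-elim (acyclic (chord-cycle P (s≤s (s≤s z≤n)) i≤l (trans (symmetric _ _) edge)))

  onPath? : (P : Path A l) (u : Fin (2 + k)) → Dec (∃ λ i → i < suc l × vertex P i ≡ u)
  onPath? {l} P u = anyUpTo? (λ i → vertex P i ≟ u) (suc l)

  grow : ∀ fuel {l} → 2 + k ≤ fuel + l → Path A (suc l) → Leaf A
  grow zero bound P = contradiction (Path-length< P) (≤⇒≯ (≤-trans bound (n≤1+n _)))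
  grow (suc fuel) {l} bound P
    with any? (λ u → (A (vertex P 0) u Boolₚ.≟ true) ×-dec ¬? (onPath? P u))
  ... | yes (u , edge , fresh) =
    grow fuel (subst (2 + k ≤_) (sym (+-suc fuel l)) bound)
              (prepend P u (trans (symmetric _ _) edge) (λ i≤ e → fresh (_ , s≤s i≤ , e)))
  ... | no no-fresh = record
    { leaf = vertex P 0 ; parent = vertex P 1 ; leaf-parent = adjacent P (s≤s z≤n) ; leaf-unique = unique }
    where
    unique : ∀ x → A (vertex P 0) x ≡ true → x ≡ vertex P 1
    unique x edge with decidable-stable (onPath? P x) (λ off → no-fresh (x , edge , off))
    ... | i , i<2+l , refl = cong (vertex P) (head-neighbour P (s≤s⁻¹ i<2+l) edge)

  start : Walk A zero (suc zero) → Leaf A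
  start (step {k = w} edge _) =
    grow (2 + k) (m≤m+n (2 + k) 0)
         (prepend (trivialPath zero) w (trans (symmetric _ _) edge)
                  (λ _ → adjacent⇒≢ {A = A} loopless edge))

-- Removing a leaf from a tree

permutation-injective : (π : Permutation′ n) → Injective _≡_ _≡_ (π ⟨$⟩ʳ_)
permutation-injective π e = trans (sym (inverseˡ π)) (trans (cong (π ⟨$⟩ˡ_) e) (inverseˡ π))

permute-isTree : {A : Adj n} (π : Permutation′ n) → IsTree A → IsTree (relabel (π ⟨$⟩ʳ_) A)
permute-isTree {A = A} π (nonempty , (symmetric , loopless) , connected , acyclic) =
  nonempty , ((λ i j → symmetric _ _) , (λ i → loopless _)) , connected′ ,
  relabel-acyclic {A = A} (permutation-injective π) acyclic
  where
  connected′ : Connected (relabel (π ⟨$⟩ʳ_) A)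
  connected′ i j = subst₂ (Walk _) (inverseˡ π) (inverseˡ π)
    (Walk-map (π ⟨$⟩ˡ_) (subst₂ (λ x y → A x y ≡ true) (sym (inverseʳ π)) (sym (inverseʳ π)))
              (connected (π ⟨$⟩ʳ i) (π ⟨$⟩ʳ j)))

PendantAt : Adj (suc n) → Fin n → Set
PendantAt B u = ∀ x → B zero x ≡ ⌊ suc u ≟ x ⌋

pendant-addLeaf : {B : Adj (suc n)} {u : Fin n} → IsGraph B → PendantAt B u →
                  B ≗₂ addLeaf (relabel suc B) u
pendant-addLeaf (symmetric , loopless) pendant zero    zero    = loopless zero
pendant-addLeaf (symmetric , loopless) pendant zero    (suc j) = trans (pendant (suc j)) (⌊≟⌋-suc _ j)
pendant-addLeaf (symmetric , loopless) pendant (suc i) zero    =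
  trans (symmetric (suc i) zero) (trans (pendant (suc i)) (⌊≟⌋-suc _ i))
pendant-addLeaf (symmetric , loopless) pendant (suc i) (suc j) = refl

-- The walk is traversed with its first vertex given up to an equation, so that the
-- detour suc u → zero → suc u can be cut out while keeping the recursion structural.
Walk-prune : {B : Adj (suc n)} {u : Fin n} → (∀ i j → B i j ≡ B j i) → PendantAt B u →
             ∀ {a i j} → Walk B a (suc j) → a ≡ suc i → Walk (relabel suc B) i j
Walk-prune symmetric pendant here refl = here
Walk-prune symmetric pendant (step {k = suc _} edge w) refl = step edge (Walk-prune symmetric pendant w refl)
Walk-prune {B = B} {u} symmetric pendant (step {k = zero} edge (step {k = x} edge′ w)) refl =
  Walk-prune symmetric pendant w (trans (sym (towards x edge′)) (towards _ (trans (symmetric _ _) edge)))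
  where
  towards : ∀ y → B zero y ≡ true → suc u ≡ y
  towards y e = ⌊≟⌋-true (trans (sym (pendant y)) e)

prune-isTree : {B : Adj (2 + n)} {u : Fin (suc n)} → IsTree B → PendantAt B u → IsTree (relabel suc B)
prune-isTree {B = B} (_ , (symmetric , loopless) , connected , acyclic) pendant =
  s≤s z≤n , ((λ i j → symmetric _ _) , (λ i → loopless _)) ,
  (λ i j → Walk-prune symmetric pendant (connected (suc i) (suc j)) refl) ,
  relabel-acyclic {A = B} suc-injective acyclic

record LeafDecomposition (A : Adj (2 + k)) : Set where
  field
    stem                  : Adj (suc k)
    stem-tree             : IsTree stem
    attachment            : Fin (suc k)
    relabelling           : Fin (2 + k) → Fin (2 + k)
    relabelling-injective : Injective _≡_ _≡_ relabelling
    decomposition         : A ≗₂ relabel relabelling (addLeaf stem attachment)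

-- Swap the leaf into position zero; its parent then sits at some suc u.
leaf-decomposition : {A : Adj (2 + k)} → IsTree A → LeafDecomposition A
leaf-decomposition {k} {A} tree@(_ , (_ , loopless) , _) = record
  { stem                  = relabel suc B
  ; stem-tree             = prune-isTree B-tree pendant
  ; attachment            = u
  ; relabelling           = π ⟨$⟩ˡ_
  ; relabelling-injective = permutation-injective (flip π)
  ; decomposition         = λ i j → trans (sym (cong₂ A (inverseʳ π) (inverseʳ π)))
                                          (pendant-addLeaf B-graph pendant (π ⟨$⟩ˡ i) (π ⟨$⟩ˡ j))
  }
  where
  open Leaf (tree-leaf tree)
  π : Permutation′ (2 + k)
  π = transpose zero leaf

  B : Adj (2 + k)
  B = relabel (π ⟨$⟩ʳ_) A

  B-tree : IsTree B
  B-tree = permute-isTree π tree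

  B-graph : IsGraph B
  B-graph = proj₁ (proj₂ B-tree)

  parent≢π0 : zero ≢ π ⟨$⟩ˡ parent
  parent≢π0 0≡π⁻¹p =
    adjacent⇒≢ {A = A} loopless leaf-parent (trans (cong (π ⟨$⟩ʳ_) 0≡π⁻¹p) (inverseʳ π))

  u : Fin (suc k)
  u = punchOut parent≢π0

  πsu≡parent : π ⟨$⟩ʳ suc u ≡ parent
  πsu≡parent = trans (cong (π ⟨$⟩ʳ_) (punchIn-punchOut parent≢π0)) (inverseʳ π)

  pendant : PendantAt B u
  pendant x = trans (leaf-row (π ⟨$⟩ʳ x))
                    (trans (cong (λ y → ⌊ y ≟ π ⟨$⟩ʳ x ⌋) (sym πsu≡parent))
                           (⌊≟⌋-injective (permutation-injective π) (suc u) x))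

-- The gadget

-- Vertices 0, 1, 2, 3 of the gadget are newHandle, freshHandle, newVertex and hub, with edges
-- h – hub, hub – newVertex, hub – freshHandle and newVertex – newHandle.
gadget : Adj n → Fin n → Adj (4 + n)
gadget A h = addLeaf (addLeaf (addLeaf (addLeaf A h) zero) (suc zero)) (suc zero)

newHandle freshHandle newVertex hub : Fin (4 + n)
newHandle   = zero
freshHandle = suc zero
newVertex   = suc (suc zero)
hub         = suc (suc (suc zero))

⇑ : Fin n → Fin (4 + n)
⇑ = 4 ↑ʳ_

⇑* : List (Fin n) → List (Fin (4 + n))
⇑* xs = map suc (map suc (map suc (map suc xs)))

gadget-isGraph : {A : Adj n} (h : Fin n) → IsGraph A → IsGraph (gadget A h)
gadget-isGraph h = addLeaf-isGraph _ ∘ addLeaf-isGraph _ ∘ addLeaf-isGraph _ ∘ addLeaf-isGraph h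

gadget-isTree : {A : Adj n} (h : Fin n) → IsTree A → IsTree (gadget A h)
gadget-isTree h = addLeaf-isTree _ ∘ addLeaf-isTree _ ∘ addLeaf-isTree _ ∘ addLeaf-isTree h

gadget-lcSeq : {A : Adj n} {h : Fin n} (xs : List (Fin n)) → All (_≢ h) xs →
               lcSeq (⇑* xs) (gadget A h) ≗₂ gadget (lcSeq xs A) h
gadget-lcSeq xs xs≢h =
  ≗₂-trans (lcSeq-addLeaf (map suc (map suc (map suc xs))) (map-suc-avoids (map-suc-avoids-zero _)))
 (addLeaf-cong (suc zero)
 (≗₂-trans (lcSeq-addLeaf (map suc (map suc xs)) (map-suc-avoids (map-suc-avoids-zero xs)))
 (addLeaf-cong (suc zero)
 (≗₂-trans (lcSeq-addLeaf (map suc xs) (map-suc-avoids-zero xs))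
 (addLeaf-cong zero (lcSeq-addLeaf xs xs≢h))))))

module _ (A : Adj n) (h : Fin n) where

  private
    A₁ : Adj (1 + n)
    A₁ = addLeaf A h
    A₂ : Adj (2 + n)
    A₂ = addLeaf A₁ zero
    A₃ : Adj (3 + n)
    A₃ = addLeaf A₂ (suc zero)

  deg-gadget-newHandle : deg (gadget A h) newHandle ≡ 1
  deg-gadget-newHandle = deg-addLeaf-leaf A₃ (suc zero)

  deg-gadget-freshHandle : deg (gadget A h) freshHandle ≡ 1
  deg-gadget-freshHandle = trans (deg-addLeaf-suc A₃ (suc zero) zero) (deg-addLeaf-leaf A₂ (suc zero))

  deg-gadget-newVertex : deg (gadget A h) newVertex ≡ 2
  deg-gadget-newVertex = trans (deg-addLeaf-suc A₃ (suc zero) (suc zero))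
                         (cong suc (trans (deg-addLeaf-suc A₂ (suc zero) zero) (deg-addLeaf-leaf A₁ zero)))

  deg-gadget-hub : deg (gadget A h) hub ≡ 3
  deg-gadget-hub = trans (deg-addLeaf-suc A₃ (suc zero) (suc (suc zero)))
                  (trans (deg-addLeaf-suc A₂ (suc zero) (suc zero))
                  (cong suc (trans (deg-addLeaf-suc A₁ zero zero) (cong suc (deg-addLeaf-leaf A h)))))

  deg-gadget-⇑ : ∀ g → deg (gadget A h) (⇑ g) ≡ (if ⌊ h ≟ g ⌋ then 1 else 0) + deg A g
  deg-gadget-⇑ g = trans (deg-addLeaf-suc A₃ (suc zero) (suc (suc (suc g))))
                  (trans (deg-addLeaf-suc A₂ (suc zero) (suc (suc g)))
                  (trans (deg-addLeaf-suc A₁ zero (suc g)) (deg-addLeaf-suc A h g)))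

gadget-subcubic : {A : Adj n} {h : Fin n} → Subcubic A → deg A h ≤ 1 → Subcubic (gadget A h)
gadget-subcubic {A = A} {h} subcubic h-pendant = bound
  where
  bound : Subcubic (gadget A h)
  bound zero                      = ≤-trans (≤-reflexive (deg-gadget-newHandle A h)) (s≤s z≤n)
  bound (suc zero)                = ≤-trans (≤-reflexive (deg-gadget-freshHandle A h)) (s≤s z≤n)
  bound (suc (suc zero))          = ≤-trans (≤-reflexive (deg-gadget-newVertex A h)) (s≤s (s≤s z≤n))
  bound (suc (suc (suc zero)))    = ≤-reflexive (deg-gadget-hub A h)
  bound (suc (suc (suc (suc g)))) rewrite deg-gadget-⇑ A h g with h ≟ g
  ... | yes refl = s≤s (≤-trans h-pendant (s≤s z≤n))
  ... | no _     = subcubic g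

module Twist (G : Adj n) (h : Fin n) where

  twisted : Adj (4 + n)
  twisted = lc (⇑ h) (lc hub (gadget G h))

  twisted-isGraph : IsGraph G → IsGraph twisted
  twisted-isGraph = lc-isGraph (⇑ h) ∘ lc-isGraph hub ∘ gadget-isGraph h

  private
    H : Adj (4 + n)
    H = lc hub (gadget G h)

    H-h-⇑ : ∀ {x} → h ≢ x → H (⇑ h) (⇑ x) ≡ G h x
    H-h-⇑ {x} h≢x rewrite ⌊≟⌋-≢ h≢x | ⌊≟⌋-refl h = xor-identityʳ (G h x)

    H-h-newVertex : H (⇑ h) newVertex ≡ true
    H-h-newVertex rewrite ⌊≟⌋-refl h = refl

    H-h-newHandle : H (⇑ h) newHandle ≡ false
    H-h-newHandle = ∧-zeroʳ _

  twisted-⇑ : ∀ {x y} → h ≢ x → h ≢ y → twisted (⇑ x) (⇑ y) ≡ lc h G x y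
  twisted-⇑ {x} {y} h≢x h≢y
    rewrite H-h-⇑ h≢x | H-h-⇑ h≢y | ⌊≟⌋-≢ h≢x | xor-identityʳ (G x y)
          | ⌊≟⌋-injective (↑ʳ-injective 4 _ _) x y = refl

  twisted-newVertex-⇑ : ∀ {y} → h ≢ y → twisted newVertex (⇑ y) ≡ G h y
  twisted-newVertex-⇑ {y} h≢y rewrite H-h-⇑ h≢y | H-h-newVertex | ⌊≟⌋-≢ h≢y = ∧-identityʳ _

  twisted-newHandle-newVertex : twisted newHandle newVertex ≡ true
  twisted-newHandle-newVertex rewrite H-h-newHandle = refl

  twisted-newHandle-⇑ : ∀ y → twisted newHandle (⇑ y) ≡ false
  twisted-newHandle-⇑ y rewrite H-h-newHandle = refl

  twisted-freshHandle-newVertex : twisted freshHandle newVertex ≡ false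
  twisted-freshHandle-newVertex rewrite H-h-newVertex = refl

  twisted-freshHandle-⇑ : ∀ {y} → h ≢ y → twisted freshHandle (⇑ y) ≡ G h y
  twisted-freshHandle-⇑ {y} h≢y
    rewrite H-h-⇑ h≢y | ⌊≟⌋-refl h | ⌊≟⌋-≢ h≢y = ∧-identityʳ _

  twisted-newHandle-freshHandle : twisted newHandle freshHandle ≡ false
  twisted-newHandle-freshHandle rewrite H-h-newHandle = refl

-- Realisations

record Realisation (T : Adj m) : Set where
  field
    size          : ℕ
    host          : Adj size
    host-tree     : IsTree host
    host-subcubic : Subcubic host
    size-bound    : size ≤ 5 * m
    pivots        : List (Fin size)
    embed handle  : Fin m → Fin size

  reduced : Adj size
  reduced = lcSeq pivots host

  field
    embed-injective     : Injective _≡_ _≡_ embed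
    embed-faithful      : T ≗₂ relabel embed reduced
    handle-pendant      : ∀ i → deg host (handle i) ≤ 1
    handle-unpivoted    : ∀ i → All (_≢ handle i) pivots
    handle≢embed        : ∀ i j → handle i ≢ embed j
    handle-marks        : ∀ i j → reduced (handle i) (embed j) ≡ ⌊ i ≟ j ⌋
    handles-independent : ∀ i j → reduced (handle i) (handle j) ≡ false

  vertexMinor : VertexMinor T host
  vertexMinor = pivots , embed , embed-injective , embed-faithful

realise-single : {T : Adj 1} → IsTree T → Realisation T
realise-single {T} tree@(_ , (_ , loopless) , _) = record
  { size                = 2
  ; host                = addLeaf T zero
  ; host-tree           = addLeaf-isTree zero tree
  ; host-subcubic       = subcubic
  ; size-bound          = s≤s (s≤s z≤n)
  ; pivots              = []
  ; embed               = suc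
  ; handle              = λ _ → zero
  ; embed-injective     = suc-injective
  ; embed-faithful      = λ _ _ → refl
  ; handle-pendant      = λ _ → ≤-reflexive (deg-addLeaf-leaf T zero)
  ; handle-unpivoted    = λ _ → []
  ; handle≢embed        = λ _ _ → 0≢1+n
  ; handle-marks        = λ { zero j → refl }
  ; handles-independent = λ _ _ → refl
  }
  where
  subcubic : Subcubic (addLeaf T zero)
  subcubic zero = ≤-trans (≤-reflexive (deg-addLeaf-leaf T zero)) (s≤s z≤n)
  subcubic (suc zero) rewrite deg-addLeaf-suc T zero zero | loopless zero = s≤s z≤n

Realisation-relabel : {T B : Adj n} (τ : Fin n → Fin n) → Injective _≡_ _≡_ τ →
                      T ≗₂ relabel τ B → Realisation B → Realisation T
Realisation-relabel τ τ-inj T≗B R = record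
  { size                = size
  ; host                = host
  ; host-tree           = host-tree
  ; host-subcubic       = host-subcubic
  ; size-bound          = size-bound
  ; pivots              = pivots
  ; embed               = embed ∘ τ
  ; handle              = handle ∘ τ
  ; embed-injective     = τ-inj ∘ embed-injective
  ; embed-faithful      = λ i j → trans (T≗B i j) (embed-faithful (τ i) (τ j))
  ; handle-pendant      = handle-pendant ∘ τ
  ; handle-unpivoted    = handle-unpivoted ∘ τ
  ; handle≢embed        = λ i j → handle≢embed (τ i) (τ j)
  ; handle-marks        = λ i j → trans (handle-marks (τ i) (τ j)) (⌊≟⌋-injective τ-inj i j)
  ; handles-independent = λ i j → handles-independent (τ i) (τ j)
  }
  where open Realisation R

module Extension {T : Adj m} (R : Realisation T) (u : Fin m) where
  open Realisation R
  open Twist reduced (handle u)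

  private
    h : Fin size
    h = handle u

    twisted-graph : IsGraph twisted
    twisted-graph = twisted-isGraph (lcSeq-isGraph pivots (proj₁ (proj₂ host-tree)))

    twisted-symmetric : ∀ i j → twisted i j ≡ twisted j i
    twisted-symmetric = proj₁ twisted-graph

    twisted-loopless : ∀ i → twisted i i ≡ false
    twisted-loopless = proj₂ twisted-graph

    h≢embed : ∀ j → h ≢ embed j
    h≢embed = handle≢embed u

    h≢handle : ∀ {i} → i ≢ u → h ≢ handle i
    h≢handle {i} i≢u h≡hi = i≢u (⌊≟⌋-true (begin
      ⌊ i ≟ u ⌋                    ≡⟨ handle-marks i u ⟨
      reduced (handle i) (embed u) ≡⟨ cong (λ x → reduced x (embed u)) h≡hi ⟨
      reduced h (embed u)          ≡⟨ handle-marks u u ⟩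
      ⌊ u ≟ u ⌋                    ≡⟨ ⌊≟⌋-refl u ⟩
      true                         ∎))
      where open ≡-Reasoning

  embed′ : Fin (suc m) → Fin (4 + size)
  embed′ zero    = newVertex
  embed′ (suc i) = ⇑ (embed i)

  handle′ : Fin (suc m) → Fin (4 + size)
  handle′ zero = newHandle
  handle′ (suc i) with i ≟ u
  ... | yes _ = freshHandle
  ... | no _  = ⇑ (handle i)

  pivots′ : List (Fin (4 + size))
  pivots′ = ⇑* pivots ++ hub ∷ ⇑ h ∷ []

  reduced′≗twisted : lcSeq pivots′ (gadget host h) ≗₂ twisted
  reduced′≗twisted i j =
    trans (cong (λ A → A i j) (lcSeq-++ (⇑* pivots) (hub ∷ ⇑ h ∷ []) (gadget host h)))
          (lcSeq-cong (hub ∷ ⇑ h ∷ []) (gadget-lcSeq pivots (handle-unpivoted u)) i j)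

  embed′-injective : Injective _≡_ _≡_ embed′
  embed′-injective {zero}  {zero}  _ = refl
  embed′-injective {suc i} {suc j} e = cong suc (embed-injective (↑ʳ-injective 4 _ _ e))

  embed′-faithful : addLeaf T u ≗₂ relabel embed′ twisted
  embed′-faithful zero    zero    = sym (twisted-loopless newVertex)
  embed′-faithful zero    (suc j) = sym (trans (twisted-newVertex-⇑ (h≢embed j)) (handle-marks u j))
  embed′-faithful (suc i) zero    =
    trans (embed′-faithful zero (suc i)) (twisted-symmetric newVertex (⇑ (embed i)))
  embed′-faithful (suc i) (suc j) =
    trans (embed-faithful i j)
          (sym (trans (twisted-⇑ (h≢embed i) (h≢embed j)) (lc-unchanged {A = reduced} joint)))
    where
    joint : reduced h (embed i) ≡ true → reduced h (embed j) ≡ true → embed i ≡ embed j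
    joint hi hj = cong embed (trans (sym (⌊≟⌋-true (trans (sym (handle-marks u i)) hi)))
                                    (⌊≟⌋-true (trans (sym (handle-marks u j)) hj)))

  handle′-pendant : ∀ i → deg (gadget host h) (handle′ i) ≤ 1
  handle′-pendant zero = ≤-reflexive (deg-gadget-newHandle host h)
  handle′-pendant (suc i) with i ≟ u
  ... | yes _ = ≤-reflexive (deg-gadget-freshHandle host h)
  ... | no i≢u rewrite deg-gadget-⇑ host h (handle i) | ⌊≟⌋-≢ (h≢handle i≢u) = handle-pendant i

  handle′-unpivoted : ∀ i → All (_≢ handle′ i) pivots′
  handle′-unpivoted zero = ++⁺ (map-suc-avoids-zero _) ((λ ()) ∷ (λ ()) ∷ [])
  handle′-unpivoted (suc i) with i ≟ u
  ... | yes _  = ++⁺ (map-suc-avoids (map-suc-avoids-zero _)) ((λ ()) ∷ (λ ()) ∷ [])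
  ... | no i≢u = ++⁺ (map-suc-avoids (map-suc-avoids (map-suc-avoids (map-suc-avoids (handle-unpivoted i)))))
                     ((λ ()) ∷ (h≢handle i≢u ∘ ↑ʳ-injective 4 _ _) ∷ [])

  handle′≢embed′ : ∀ i j → handle′ i ≢ embed′ j
  handle′≢embed′ zero    zero    ()
  handle′≢embed′ zero    (suc j) ()
  handle′≢embed′ (suc i) j with i ≟ u | j
  ... | yes _  | zero  = λ ()
  ... | yes _  | suc _ = λ ()
  ... | no _   | zero  = λ ()
  ... | no _   | suc j = handle≢embed i j ∘ ↑ʳ-injective 4 _ _

  handle′-marks : ∀ i j → twisted (handle′ i) (embed′ j) ≡ ⌊ i ≟ j ⌋
  handle′-marks zero    zero    = twisted-newHandle-newVertex
  handle′-marks zero    (suc j) = twisted-newHandle-⇑ (embed j)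
  handle′-marks (suc i) j with i ≟ u | j
  ... | yes refl | zero  = twisted-freshHandle-newVertex
  ... | yes refl | suc j =
    trans (twisted-freshHandle-⇑ (h≢embed j)) (trans (handle-marks u j) (sym (⌊≟⌋-suc u j)))
  ... | no i≢u   | zero  =
    trans (twisted-symmetric (⇑ (handle i)) newVertex)
          (trans (twisted-newVertex-⇑ (h≢handle i≢u)) (handles-independent u i))
  ... | no i≢u   | suc j =
    trans (twisted-⇑ (h≢handle i≢u) (h≢embed j))
          (trans (lc-unchanged-off {A = reduced} (handles-independent u i))
                 (trans (handle-marks i j) (sym (⌊≟⌋-suc i j))))

  private
    newHandle-row : ∀ j → twisted newHandle (handle′ j) ≡ false
    newHandle-row zero = twisted-loopless newHandle
    newHandle-row (suc j) with j ≟ u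
    ... | yes _ = twisted-newHandle-freshHandle
    ... | no _  = twisted-newHandle-⇑ (handle j)

    freshHandle-row : ∀ j → twisted freshHandle (handle′ j) ≡ false
    freshHandle-row zero = trans (twisted-symmetric freshHandle newHandle) twisted-newHandle-freshHandle
    freshHandle-row (suc j) with j ≟ u
    ... | yes _  = twisted-loopless freshHandle
    ... | no j≢u = trans (twisted-freshHandle-⇑ (h≢handle j≢u)) (handles-independent u j)

    ⇑handle-row : ∀ {i} → i ≢ u → ∀ j → twisted (⇑ (handle i)) (handle′ j) ≡ false
    ⇑handle-row {i} i≢u zero =
      trans (twisted-symmetric (⇑ (handle i)) newHandle) (twisted-newHandle-⇑ (handle i))
    ⇑handle-row {i} i≢u (suc j) with j ≟ u
    ... | yes _  = trans (twisted-symmetric (⇑ (handle i)) freshHandle)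
                         (trans (twisted-freshHandle-⇑ (h≢handle i≢u)) (handles-independent u i))
    ... | no j≢u = trans (twisted-⇑ (h≢handle i≢u) (h≢handle j≢u))
                         (trans (lc-unchanged-off {A = reduced} (handles-independent u i)) (handles-independent i j))

  handles′-independent : ∀ i j → twisted (handle′ i) (handle′ j) ≡ false
  handles′-independent zero = newHandle-row
  handles′-independent (suc i) with i ≟ u
  ... | yes _  = freshHandle-row
  ... | no i≢u = ⇑handle-row i≢u

  size-bound′ : 4 + size ≤ 5 * suc m
  size-bound′ = begin
    4 + size      ≤⟨ +-monoʳ-≤ 4 size-bound ⟩
    4 + 5 * m     ≤⟨ n≤1+n _ ⟩
    5 + 5 * m     ≡⟨ *-suc 5 m ⟨
    5 * suc m     ∎
    where open ≤-Reasoning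

  extend : Realisation (addLeaf T u)
  extend = record
    { size                = 4 + size
    ; host                = gadget host h
    ; host-tree           = gadget-isTree h host-tree
    ; host-subcubic       = gadget-subcubic host-subcubic (handle-pendant u)
    ; size-bound          = size-bound′
    ; pivots              = pivots′
    ; embed               = embed′
    ; handle              = handle′
    ; embed-injective     = embed′-injective
    ; embed-faithful      = ≗₂-trans embed′-faithful (λ i j → sym (reduced′≗twisted (embed′ i) (embed′ j)))
    ; handle-pendant      = handle′-pendant
    ; handle-unpivoted    = handle′-unpivoted
    ; handle≢embed        = handle′≢embed′
    ; handle-marks        = λ i j → trans (reduced′≗twisted _ (embed′ j)) (handle′-marks i j)
    ; handles-independent = λ i j → trans (reduced′≗twisted _ (handle′ j)) (handles′-independent i j)
    }

realise : ∀ n (T : Adj n) → IsTree T → Realisation T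
realise zero          T (() , _)
realise (suc zero)    T tree = realise-single tree
realise (suc (suc k)) T tree =
  Realisation-relabel relabelling relabelling-injective decomposition
    (Extension.extend (realise (suc k) stem stem-tree) attachment)
  where open LeafDecomposition (leaf-decomposition tree)

lemma4p3 : (n : ℕ) (T : Adj n) → IsTree T →
    Σ ℕ λ n′ → Σ (Adj n′) λ T′ →
      IsTree T′ × Subcubic T′ × n′ ≤ 5 * n × VertexMinor T T′
lemma4p3 n T tree = size , host , host-tree , host-subcubic , size-bound , vertexMinor
  where open Realisation (realise n T tree)
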